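{- Let $G$ be a centerless group and $A\subseteq G$ such that $(G,A)$ is a special pair. Then for every ordinal $\alpha$: (1) $(G^\alpha,A)$ is a special pair; (2) $C_{G^\alpha}(A)=\{e\}$.
   Context: For a group $G$, $A\subseteq G$, $x\in G$, $tp_{qf}(x,A,G)$ is the set of group words $\sigma(z,\bar a)$ in one variable $z$ with parameters from $A$ such that $\sigma(x,\bar a)=e$ in $G$; $(G,A)$ is special if $A\subseteq G$ and $tp_{qf}(x,A,G)=tp_{qf}(y,A,G)$ implies $x=y$. For a centerless group $G$, the automorphism tower is $G^0=G$, $G^{\alpha+1}=\mathrm{Aut}(G^\alpha)$ (identifying $G^\alpha$ with $\mathrm{Inn}(G^\alpha)$), $G^\delta=\bigcup_{\alpha<\delta}G^\alpha$ for limit $\delta$. $C_H(A)$ is the centralizer of $A$ in $H$. -}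

module Defs where

open import Level using (Level; _⊔_; suc)
open import Algebra.Bundles using (Group)
open import Data.Product using (Σ; _×_; _,_; proj₁; ∃-syntax)
open import Data.Sum using (_⊎_; inj₁; inj₂)
open import Relation.Binary.PropositionalEquality using (_≡_)
open import Relation.Nullary using (¬_)
open import Induction.WellFounded using (WellFounded)

-- Group words in one variable z with parameters from a type P
-- (σ(z, ā) with ā from A).

data Word {p} (P : Set p) : Set p where
  var : Word P
  par : P → Word P
  one : Word P
  _·_ : Word P → Word P → Word P
  inv : Word P → Word P

module _ {c ℓ} (H : Group c ℓ) where
  open Group H using (Carrier; _≈_; _∙_; ε; _⁻¹)

  eval : ∀ {p} {P : Set p} → (P → Carrier) → Word P → Carrier → Carrier
  eval ι var       x = x
  eval ι (par a)   x = ι a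
  eval ι one       x = ε
  eval ι (σ · τ)   x = eval ι σ x ∙ eval ι τ x
  eval ι (inv σ)   x = eval ι σ x ⁻¹

  SameQfType : ∀ {p} {P : Set p} → (P → Carrier) → Carrier → Carrier → Set (p ⊔ ℓ)
  SameQfType ι x y = ∀ σ → (eval ι σ x ≈ ε → eval ι σ y ≈ ε)
                         × (eval ι σ y ≈ ε → eval ι σ x ≈ ε)

  -- (H, A) is special, where A is given as the image of ι : P → H
  Special : ∀ {p} {P : Set p} → (P → Carrier) → Set (p ⊔ c ⊔ ℓ)
  Special ι = ∀ x y → SameQfType ι x y → x ≈ y

  TrivialCentralizer : ∀ {p} {P : Set p} → (P → Carrier) → Set (p ⊔ c ⊔ ℓ)
  TrivialCentralizer ι = ∀ x → (∀ a → x ∙ ι a ≈ ι a ∙ x) → x ≈ ε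

  Centerless : Set (c ⊔ ℓ)
  Centerless = ∀ z → (∀ g → z ∙ g ≈ g ∙ z) → z ≈ ε

  record Automorphism : Set (c ⊔ ℓ) where
    field
      fun      : Carrier → Carrier
      inverse : Carrier → Carrier
      fun-cong : ∀ {x y} → x ≈ y → fun x ≈ fun y
      inv-cong : ∀ {x y} → x ≈ y → inverse x ≈ inverse y
      fun-hom  : ∀ x y → fun (x ∙ y) ≈ fun x ∙ fun y
      aut-invˡ : ∀ x → fun (inverse x) ≈ x
      aut-invʳ : ∀ x → inverse (fun x) ≈ x

  open Automorphism public

  _≈ᴬ_ : Automorphism → Automorphism → Set (c ⊔ ℓ)
  f ≈ᴬ g = ∀ x → fun f x ≈ fun g x

-- Ordinals: an arbitrary well-order (O, <) with least element 𝟘.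
-- "Every ordinal α" is read as "every element of an arbitrary such
-- well-order", with the tower defined along the whole order.

record WellOrder (o r : Level) : Set (suc (o ⊔ r)) where
  field
    O        : Set o
    _<_      : O → O → Set r
    <-trans  : ∀ {α β γ} → α < β → β < γ → α < γ
    <-tri    : ∀ α β → α < β ⊎ α ≡ β ⊎ β < α
    <-irrefl : ∀ {α} → ¬ (α < α)
    <-wf     : WellFounded _<_
    𝟘        : O

  _≤_ : O → O → Set (o ⊔ r)
  α ≤ β = α ≡ β ⊎ α < β

  field
    𝟘-least  : ∀ α → 𝟘 ≤ α

  IsSucc : O → O → Set (o ⊔ r)
  IsSucc α β = α < β × (∀ γ → α < γ → β ≤ γ)

  IsLimit : O → Set (o ⊔ r)
  IsLimit δ = ¬ (δ ≡ 𝟘) × (∀ α → ¬ IsSucc α δ)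

  field
    classify : ∀ α → α ≡ 𝟘 ⊎ (Σ O λ β → IsSucc β α) ⊎ IsLimit α

-- The automorphism tower of the centerless group  H 𝟘  along W:
-- groups H α with embeddings ι : H β → H α for β ≤ α, such that
--   * the embeddings are injective homomorphisms, coherent, ι on α ≤ α is id;
--   * if β = α + 1, then H β ≅ Aut(H α) via some φ, and φ sends the
--     (embedded) element x of H α to the inner automorphism g ↦ x g x⁻¹;
--   * if δ is a limit, H δ is the union of the H α, α < δ.

record IsAutTower {o r ℓ} (W : WellOrder o r) (H : WellOrder.O W → Group ℓ ℓ)
       : Set (o ⊔ r ⊔ suc ℓ) where
  open WellOrder W
  open Group using (Carrier; _≈_; _∙_; _⁻¹)
  field
    ι        : ∀ {β α} → β ≤ α → Carrier (H β) → Carrier (H α)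
    ι-cong   : ∀ {β α} (p : β ≤ α) {x y} → _≈_ (H β) x y → _≈_ (H α) (ι p x) (ι p y)
    ι-hom    : ∀ {β α} (p : β ≤ α) x y → _≈_ (H α) (ι p (_∙_ (H β) x y)) (_∙_ (H α) (ι p x) (ι p y))
    ι-inj    : ∀ {β α} (p : β ≤ α) x y → _≈_ (H α) (ι p x) (ι p y) → _≈_ (H β) x y
    ι-coh    : ∀ {β α γ} (p : β ≤ α) (q : α ≤ γ) (r : β ≤ γ) x →
               _≈_ (H γ) (ι q (ι p x)) (ι r x)
    ι-id     : ∀ {α} (p : α ≤ α) x → _≈_ (H α) (ι p x) x
    succ-aut : ∀ {α β} → (s : IsSucc α β) →
               Σ (Carrier (H β) → Automorphism (H α)) λ φ →
                 (∀ {x y} → _≈_ (H β) x y → _≈ᴬ_ (H α) (φ x) (φ y))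
               × (∀ x y g → _≈_ (H α) (fun (φ (_∙_ (H β) x y)) g)
                                        (fun (φ x) (fun (φ y) g)))
               × (∀ x y → _≈ᴬ_ (H α) (φ x) (φ y) → _≈_ (H β) x y)
               × (∀ f → Σ (Carrier (H β)) λ x → _≈ᴬ_ (H α) (φ x) f)
               × (∀ x g → _≈_ (H α) (fun (φ (ι (inj₂ (proj₁ s)) x)) g)
                                    (_∙_ (H α) (_∙_ (H α) x g) (_⁻¹ (H α) x)))
    limit-union : ∀ {δ} → IsLimit δ → ∀ y →
               Σ O λ α → Σ (α < δ) λ p → Σ (Carrier (H α)) λ x →
                 _≈_ (H δ) (ι (inj₂ p) x) y

-- The key fact is rigidity: in a special pair (G, A), an injective endomorphism
-- fixing A pointwise is the identity, since it preserves quantifier-free types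
-- over A. For the successor step, an element x of Aut(G) is determined by the
-- values x(a), a ∈ A (rigidity applied to x⁻¹y), and x(a) is the conjugate
-- x a x⁻¹ computed in Aut(G), whose type over A is determined by the type of x
-- via the word z a z⁻¹; so the type of x determines x. Conjugation by an element
-- centralizing A fixes A, hence is trivial, which gives the trivial centralizer.
-- Limit steps hold because any two elements of a union lie in a common stage.
module Submission where

open import Defs
open import Algebra.Bundles using (Group)
open import Data.Product using (Σ; _×_; _,_; proj₁; proj₂)
open import Data.Sum using (inj₁; inj₂)
open import Function.Base using (_∘_)
open import Function.Bundles using (_⇔_; mk⇔; Equivalence)
open import Function.Properties.Equivalence using () renaming (sym to ⇔-sym; trans to ⇔-trans)
open import Induction.WellFounded using (WfRec; module All)
open import Level using (_⊔_)
import Relation.Binary.PropositionalEquality as ≡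
import Algebra.Properties.Group as GroupProperties
import Relation.Binary.Reasoning.Setoid as SetoidReasoning

_[_] : ∀ {p} {P : Set p} → Word P → Word P → Word P
var     [ ρ ] = ρ
par a   [ ρ ] = par a
one     [ ρ ] = one
(σ · τ) [ ρ ] = (σ [ ρ ]) · (τ [ ρ ])
inv σ   [ ρ ] = inv (σ [ ρ ])

SameQfTypeAcross : ∀ {c₁ ℓ₁ c₂ ℓ₂ p} (G : Group c₁ ℓ₁) (K : Group c₂ ℓ₂) {P : Set p} →
                   (P → Group.Carrier G) → (P → Group.Carrier K) →
                   Group.Carrier G → Group.Carrier K → Set (p ⊔ ℓ₁ ⊔ ℓ₂)
SameQfTypeAcross G K ιG ιK x x' =
  ∀ σ → Group._≈_ G (eval G ιG σ x) (Group.ε G) ⇔ Group._≈_ K (eval K ιK σ x') (Group.ε K)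

module WordEvaluation {c ℓ} (G : Group c ℓ) where
  open Group G

  module _ {p} {P : Set p} (ι : P → Carrier) where

    eval-cong : ∀ σ {x y} → x ≈ y → eval G ι σ x ≈ eval G ι σ y
    eval-cong var     x≈y = x≈y
    eval-cong (par a) x≈y = refl
    eval-cong one     x≈y = refl
    eval-cong (σ · τ) x≈y = ∙-cong (eval-cong σ x≈y) (eval-cong τ x≈y)
    eval-cong (inv σ) x≈y = ⁻¹-cong (eval-cong σ x≈y)

    eval-[] : ∀ σ ρ x → eval G ι (σ [ ρ ]) x ≈ eval G ι σ (eval G ι ρ x)
    eval-[] var     ρ x = refl
    eval-[] (par a) ρ x = refl
    eval-[] one     ρ x = refl
    eval-[] (σ · τ) ρ x = ∙-cong (eval-[] σ ρ x) (eval-[] τ ρ x)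
    eval-[] (inv σ) ρ x = ⁻¹-cong (eval-[] σ ρ x)

    toAcross : ∀ {x y} → SameQfType G ι x y → SameQfTypeAcross G G ι ι x y
    toAcross st σ = mk⇔ (proj₁ (st σ)) (proj₂ (st σ))

    fromAcross : ∀ {x y} → SameQfTypeAcross G G ι ι x y → SameQfType G ι x y
    fromAcross st σ = Equivalence.to (st σ) , Equivalence.from (st σ)

    ≈⇒SameQfTypeAcross : ∀ {x y} → x ≈ y → SameQfTypeAcross G G ι ι x y
    ≈⇒SameQfTypeAcross x≈y σ =
      mk⇔ (trans (sym (eval-cong σ x≈y))) (trans (eval-cong σ x≈y))

    SameQfType-resp : ∀ {x x′ y y′} → x ≈ x′ → y ≈ y′ →
                      SameQfType G ι x y → SameQfType G ι x′ y′
    SameQfType-resp x≈x′ y≈y′ st = fromAcross λ σ →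
      ⇔-trans (⇔-sym (≈⇒SameQfTypeAcross x≈x′ σ))
              (⇔-trans (toAcross st σ) (≈⇒SameQfTypeAcross y≈y′ σ))

    SameQfType-eval : ∀ {x y} → SameQfType G ι x y →
                      ∀ ρ → SameQfType G ι (eval G ι ρ x) (eval G ι ρ y)
    SameQfType-eval st ρ σ =
      (λ σρx≈ε → trans (sym (eval-[] σ ρ _)) (proj₁ (st (σ [ ρ ])) (trans (eval-[] σ ρ _) σρx≈ε))) ,
      (λ σρy≈ε → trans (sym (eval-[] σ ρ _)) (proj₂ (st (σ [ ρ ])) (trans (eval-[] σ ρ _) σρy≈ε)))

  eval-congᵖ : ∀ {p} {P : Set p} {ι ι′ : P → Carrier} → (∀ a → ι a ≈ ι′ a) →
               ∀ σ x → eval G ι σ x ≈ eval G ι′ σ x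
  eval-congᵖ ι≈ι′ var     x = refl
  eval-congᵖ ι≈ι′ (par a) x = ι≈ι′ a
  eval-congᵖ ι≈ι′ one     x = refl
  eval-congᵖ ι≈ι′ (σ · τ) x = ∙-cong (eval-congᵖ ι≈ι′ σ x) (eval-congᵖ ι≈ι′ τ x)
  eval-congᵖ ι≈ι′ (inv σ) x = ⁻¹-cong (eval-congᵖ ι≈ι′ σ x)

  Special-resp : ∀ {p} {P : Set p} {ι ι′ : P → Carrier} → (∀ a → ι a ≈ ι′ a) →
                 Special G ι → Special G ι′
  Special-resp ι≈ι′ special x y st = special x y λ σ →
    (λ σx≈ε → trans (E σ y) (proj₁ (st σ) (trans (sym (E σ x)) σx≈ε))) ,
    (λ σy≈ε → trans (E σ x) (proj₂ (st σ) (trans (sym (E σ y)) σy≈ε)))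
    where E = eval-congᵖ ι≈ι′

module Conjugation {c ℓ} (G : Group c ℓ) where
  open Group G
  open GroupProperties G
  open SetoidReasoning setoid

  conj : Carrier → Carrier → Carrier
  conj x g = x ∙ g ∙ x ⁻¹

  conj-congʳ : ∀ x {g h} → g ≈ h → conj x g ≈ conj x h
  conj-congʳ x g≈h = ∙-congʳ (∙-congˡ g≈h)

  conj-hom : ∀ x g h → conj x (g ∙ h) ≈ conj x g ∙ conj x h
  conj-hom x g h = begin
    x ∙ (g ∙ h) ∙ x ⁻¹             ≈⟨ ∙-congʳ (assoc x g h) ⟨
    x ∙ g ∙ h ∙ x ⁻¹               ≈⟨ ∙-congʳ (∙-congʳ (//-rightDividesˡ x (x ∙ g))) ⟨
    x ∙ g ∙ x ⁻¹ ∙ x ∙ h ∙ x ⁻¹    ≈⟨ ∙-congʳ (assoc (x ∙ g ∙ x ⁻¹) x h) ⟩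
    x ∙ g ∙ x ⁻¹ ∙ (x ∙ h) ∙ x ⁻¹  ≈⟨ assoc (x ∙ g ∙ x ⁻¹) (x ∙ h) (x ⁻¹) ⟩
    conj x g ∙ conj x h            ∎

  conj-injective : ∀ x g h → conj x g ≈ conj x h → g ≈ h
  conj-injective x g h e = ∙-cancelˡ x g h (∙-cancelʳ (x ⁻¹) (x ∙ g) (x ∙ h) e)

  conj-ε : ∀ g → conj ε g ≈ g
  conj-ε g = trans (∙-cong (identityˡ g) ε⁻¹≈ε) (identityʳ g)

  commute⇒conj-fixed : ∀ x g → x ∙ g ≈ g ∙ x → conj x g ≈ g
  commute⇒conj-fixed x g xg≈gx = trans (∙-congʳ xg≈gx) (//-rightDividesʳ x g)

  conj-fixed⇒commute : ∀ x g → conj x g ≈ g → x ∙ g ≈ g ∙ x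
  conj-fixed⇒commute x g xgx⁻¹≈g = trans (sym (//-rightDividesˡ x (x ∙ g))) (∙-congʳ xgx⁻¹≈g)

module Homomorphism {c₁ ℓ₁ c₂ ℓ₂} (G : Group c₁ ℓ₁) (K : Group c₂ ℓ₂)
  (h : Group.Carrier G → Group.Carrier K)
  (h-cong : ∀ {x y} → Group._≈_ G x y → Group._≈_ K (h x) (h y))
  (h-hom : ∀ x y → Group._≈_ K (h (Group._∙_ G x y)) (Group._∙_ K (h x) (h y))) where
  private
    module G = Group G
    module K = Group K
    module PK = GroupProperties K
  open Conjugation

  h-ε : h G.ε K.≈ K.ε
  h-ε = PK.identityˡ-unique (h G.ε) (h G.ε) (K.trans (K.sym (h-hom G.ε G.ε)) (h-cong (G.identityˡ G.ε)))

  h-⁻¹ : ∀ x → h (x G.⁻¹) K.≈ h x K.⁻¹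
  h-⁻¹ x = PK.inverseʳ-unique (h x) (h (x G.⁻¹))
    (K.trans (K.sym (h-hom x (x G.⁻¹))) (K.trans (h-cong (G.inverseʳ x)) h-ε))

  h-conj : ∀ x g → h (conj G x g) K.≈ conj K (h x) (h g)
  h-conj x g = K.trans (h-hom (x G.∙ g) (x G.⁻¹))
    (K.∙-cong (h-hom x g) (h-⁻¹ x))

  eval-homo : ∀ {p} {P : Set p} (ι : P → G.Carrier) σ x →
              h (eval G ι σ x) K.≈ eval K (h ∘ ι) σ (h x)
  eval-homo ι var     x = K.refl
  eval-homo ι (par a) x = K.refl
  eval-homo ι one     x = h-ε
  eval-homo ι (σ · τ) x = K.trans (h-hom _ _) (K.∙-cong (eval-homo ι σ x) (eval-homo ι τ x))
  eval-homo ι (inv σ) x = K.trans (h-⁻¹ _) (K.⁻¹-cong (eval-homo ι σ x))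

  module Injective (h-inj : ∀ x y → h x K.≈ h y → x G.≈ y) where

    h≈ε⇔≈ε : ∀ x → (x G.≈ G.ε) ⇔ (h x K.≈ K.ε)
    h≈ε⇔≈ε x = mk⇔ (λ x≈ε → K.trans (h-cong x≈ε) h-ε)
                   (λ hx≈ε → h-inj x G.ε (K.trans hx≈ε (K.sym h-ε)))

    module _ {p} {P : Set p} {ιG : P → G.Carrier} {ιK : P → K.Carrier}
             (h-ι : ∀ a → h (ιG a) K.≈ ιK a) where

      SameQfTypeAcross-h : ∀ x → SameQfTypeAcross G K ιG ιK x (h x)
      SameQfTypeAcross-h x σ = ⇔-trans (h≈ε⇔≈ε (eval G ιG σ x))
        (mk⇔ (K.trans (K.sym E)) (K.trans E))
        where E = K.trans (eval-homo ιG σ x) (WordEvaluation.eval-congᵖ K h-ι σ (h x))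

      SameQfType-reflect : ∀ x y → SameQfType K ιK (h x) (h y) → SameQfType G ιG x y
      SameQfType-reflect x y st = WordEvaluation.fromAcross G ιG λ σ →
        ⇔-trans (SameQfTypeAcross-h x σ)
          (⇔-trans (WordEvaluation.toAcross K ιK st σ) (⇔-sym (SameQfTypeAcross-h y σ)))

      centralizes-reflect : ∀ x → (∀ a → h x K.∙ ιK a K.≈ ιK a K.∙ h x) →
                            ∀ a → x G.∙ ιG a G.≈ ιG a G.∙ x
      centralizes-reflect x comm a = h-inj _ _ (begin
        h (x G.∙ ιG a)    ≈⟨ h-hom x (ιG a) ⟩
        h x K.∙ h (ιG a)  ≈⟨ K.∙-congˡ (h-ι a) ⟩
        h x K.∙ ιK a      ≈⟨ comm a ⟩
        ιK a K.∙ h x      ≈⟨ K.∙-congʳ (h-ι a) ⟨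
        h (ιG a) K.∙ h x  ≈⟨ h-hom (ιG a) x ⟨
        h (ιG a G.∙ x)    ∎)
        where open SetoidReasoning K.setoid

module Rigidity {c ℓ} (G : Group c ℓ) where
  open Group G

  special⇒rigid : ∀ {p} {P : Set p} (ι : P → Carrier) → Special G ι →
    (f : Carrier → Carrier) (f-cong : ∀ {x y} → x ≈ y → f x ≈ f y)
    (f-hom : ∀ x y → f (x ∙ y) ≈ f x ∙ f y) (f-inj : ∀ x y → f x ≈ f y → x ≈ y) →
    (∀ a → f (ι a) ≈ ι a) → ∀ g → f g ≈ g
  special⇒rigid ι special f f-cong f-hom f-inj f-ι g =
    special (f g) g (WordEvaluation.fromAcross G ι (⇔-sym ∘ SameQfTypeAcross-h f-ι g))
    where open Homomorphism.Injective G G f f-cong f-hom f-inj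

  special⇒trivialCentralizer : ∀ {p} {P : Set p} (ι : P → Carrier) → Special G ι →
    Centerless G → TrivialCentralizer G ι
  special⇒trivialCentralizer ι special centerless x comm = centerless x λ g →
    conj-fixed⇒commute x g (special⇒rigid ι special (conj x) (conj-congʳ x)
      (conj-hom x) (conj-injective x) (λ a → commute⇒conj-fixed x (ι a) (comm a)) g)
    where open Conjugation G

module AutomorphismGroup {c₁ ℓ₁ c₂ ℓ₂} (B : Group c₁ ℓ₁) (S : Group c₂ ℓ₂)
  (e : Group.Carrier B → Group.Carrier S)
  (e-cong : ∀ {x y} → Group._≈_ B x y → Group._≈_ S (e x) (e y))
  (e-hom : ∀ x y → Group._≈_ S (e (Group._∙_ B x y)) (Group._∙_ S (e x) (e y)))
  (e-inj : ∀ x y → Group._≈_ S (e x) (e y) → Group._≈_ B x y)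
  (φ : Group.Carrier S → Automorphism B)
  (φ-cong : ∀ {x y} → Group._≈_ S x y → _≈ᴬ_ B (φ x) (φ y))
  (φ-∙ : ∀ x y g → Group._≈_ B (fun (φ (Group._∙_ S x y)) g) (fun (φ x) (fun (φ y) g)))
  (φ-inj : ∀ x y → _≈ᴬ_ B (φ x) (φ y) → Group._≈_ S x y)
  (φ-e : ∀ b g → Group._≈_ B (fun (φ (e b)) g) (Conjugation.conj B b g))
  {p} {P : Set p} (ιB : P → Group.Carrier B) (ιS : P → Group.Carrier S)
  (e-ι : ∀ a → Group._≈_ S (e (ιB a)) (ιS a))
  (special : Special B ιB) where
  private
    module B = Group B
    module S = Group S
    module PS = GroupProperties S
    module HomE = Homomorphism B S e e-cong e-hom
  open Conjugation

  F : S.Carrier → B.Carrier → B.Carrier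
  F x = fun (φ x)

  F-ε : ∀ g → F S.ε g B.≈ g
  F-ε g = B.trans (φ-cong (S.sym HomE.h-ε) g) (B.trans (φ-e B.ε g) (conj-ε B g))

  F-inverseʳ : ∀ x g → F x (F (x S.⁻¹) g) B.≈ g
  F-inverseʳ x g = B.trans (B.sym (φ-∙ x (x S.⁻¹) g)) (B.trans (φ-cong (S.inverseʳ x) g) (F-ε g))

  F-inverseˡ : ∀ x g → F (x S.⁻¹) (F x g) B.≈ g
  F-inverseˡ x g = B.trans (B.sym (φ-∙ (x S.⁻¹) x g)) (B.trans (φ-cong (S.inverseˡ x) g) (F-ε g))

  F-injective : ∀ x g h → F x g B.≈ F x h → g B.≈ h
  F-injective x g h Fg≈Fh = B.trans (B.sym (F-inverseˡ x g))
    (B.trans (fun-cong (φ (x S.⁻¹)) Fg≈Fh) (F-inverseˡ x h))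

  e-F : ∀ x b → e (F x b) S.≈ conj S x (e b)
  e-F x b = φ-inj _ _ λ g → begin
    F (e (F x b)) g                      ≈⟨ φ-e (F x b) g ⟩
    conj B (F x b) g                     ≈⟨ conj-congʳ B (F x b) (F-inverseʳ x g) ⟨
    conj B (F x b) (F x (F x⁻¹ g))       ≈⟨ HomF.h-conj b (F x⁻¹ g) ⟨
    F x (conj B b (F x⁻¹ g))             ≈⟨ fun-cong (φ x) (φ-e b (F x⁻¹ g)) ⟨
    F x (F (e b) (F x⁻¹ g))              ≈⟨ φ-∙ x (e b) (F x⁻¹ g) ⟨
    F (x S.∙ e b) (F x⁻¹ g)              ≈⟨ φ-∙ (x S.∙ e b) x⁻¹ g ⟨
    F (conj S x (e b)) g                 ∎
    where
      open SetoidReasoning B.setoid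
      module HomF = Homomorphism B B (F x) (fun-cong (φ x)) (fun-hom (φ x))
      x⁻¹ : S.Carrier
      x⁻¹ = x S.⁻¹

  fixes-params⇒ε : ∀ x → (∀ a → F x (ιB a) B.≈ ιB a) → x S.≈ S.ε
  fixes-params⇒ε x F-ι = φ-inj x S.ε λ g → B.trans
    (Rigidity.special⇒rigid B ιB special (F x) (fun-cong (φ x)) (fun-hom (φ x)) (F-injective x) F-ι g)
    (B.sym (F-ε g))

  agrees-on-params⇒≈ : ∀ x y → (∀ a → F x (ιB a) B.≈ F y (ιB a)) → x S.≈ y
  agrees-on-params⇒≈ x y agree = S.sym (S.trans
    (PS.inverseʳ-unique (x S.⁻¹) y (fixes-params⇒ε (x S.⁻¹ S.∙ y) λ a →
      B.trans (φ-∙ (x S.⁻¹) y (ιB a))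
        (B.trans (fun-cong (φ (x S.⁻¹)) (B.sym (agree a))) (F-inverseˡ x (ιB a)))))
    (PS.⁻¹-involutive x))

  trivialCentralizer-S : TrivialCentralizer S ιS
  trivialCentralizer-S x comm = fixes-params⇒ε x λ a → e-inj _ _ (begin
    e (F x (ιB a))       ≈⟨ e-F x (ιB a) ⟩
    conj S x (e (ιB a))  ≈⟨ conj-congʳ S x (e-ι a) ⟩
    conj S x (ιS a)      ≈⟨ commute⇒conj-fixed S x (ιS a) (comm a) ⟩
    ιS a                 ≈⟨ e-ι a ⟨
    e (ιB a)             ∎)
    where open SetoidReasoning S.setoid

  special-S : Special S ιS
  special-S x y st = agrees-on-params⇒≈ x y λ a →
    special _ _ (WordEvaluation.fromAcross B ιB λ σ →
      ⇔-trans (Across-conj x a σ)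
        (⇔-trans (WordEvaluation.toAcross S ιS (conjugates-same-type a) σ)
                 (⇔-sym (Across-conj y a σ))))
    where
      open HomE.Injective e-inj using (SameQfTypeAcross-h)
      conjWord : P → Word P
      conjWord a = (var · par a) · inv var
      conjugates-same-type : ∀ a → SameQfType S ιS (conj S x (ιS a)) (conj S y (ιS a))
      conjugates-same-type = WordEvaluation.SameQfType-eval S ιS st ∘ conjWord
      Across-conj : ∀ z a → SameQfTypeAcross B S ιB ιS (F z (ιB a)) (conj S z (ιS a))
      Across-conj z a σ = ⇔-trans (SameQfTypeAcross-h e-ι (F z (ιB a)) σ)
        (WordEvaluation.≈⇒SameQfTypeAcross S ιS
          (S.trans (e-F z (ιB a)) (conj-congʳ S z (e-ι a))) σ)

module AutomorphismTower {o r ℓ} (W : WellOrder o r) (H : WellOrder.O W → Group ℓ ℓ)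
  (T : IsAutTower W H) (A : Group.Carrier (H (WellOrder.𝟘 W)) → Set ℓ) where
  open WellOrder W
  open IsAutTower T
  module H (α : O) = Group (H α)

  ιA : ∀ α → Σ _ A → H.Carrier α
  ιA α a = ι (𝟘-least α) (proj₁ a)

  Good : O → Set ℓ
  Good α = Special (H α) (ιA α) × TrivialCentralizer (H α) (ιA α)

  ι-irrelevant : ∀ {β α} (p q : β ≤ α) x → H._≈_ α (ι p x) (ι q x)
  ι-irrelevant {α = α} p q x =
    H.trans α (H.sym α (ι-id (inj₁ ≡.refl) (ι p x))) (ι-coh p (inj₁ ≡.refl) q x)

  ι-ιA : ∀ {β α} (p : β ≤ α) a → H._≈_ α (ι p (ιA β a)) (ιA α a)
  ι-ιA {β} p a = ι-coh (𝟘-least β) p (𝟘-least _) (proj₁ a)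

  good-𝟘 : Centerless (H 𝟘) → Special (H 𝟘) proj₁ → Good 𝟘
  good-𝟘 centerless special =
    special𝟘 , Rigidity.special⇒trivialCentralizer (H 𝟘) (ιA 𝟘) special𝟘 centerless
    where
      special𝟘 : Special (H 𝟘) (ιA 𝟘)
      special𝟘 = WordEvaluation.Special-resp (H 𝟘) (λ a → H.sym 𝟘 (ι-id _ _)) special

  good-succ : ∀ {β α} → IsSucc β α → Good β → Good α
  good-succ {β} {α} s (special , _) with succ-aut s
  ... | φ , φ-cong , φ-∙ , φ-inj , _ , φ-e =
    Step.special-S , Step.trivialCentralizer-S
    where
      p : β ≤ α
      p = inj₂ (proj₁ s)
      module Step = AutomorphismGroup (H β) (H α) (ι p) (ι-cong p) (ι-hom p) (ι-inj p)
        φ φ-cong φ-∙ φ-inj φ-e (ιA β) (ιA α) (ι-ιA p) special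

  common-stage : ∀ {δ} → IsLimit δ → ∀ x y →
    Σ O λ γ → Σ (γ < δ) λ γ<δ → Σ (H.Carrier γ) λ x′ → Σ (H.Carrier γ) λ y′ →
      H._≈_ δ (ι (inj₂ γ<δ) x′) x × H._≈_ δ (ι (inj₂ γ<δ) y′) y
  common-stage {δ} L x y with limit-union L x | limit-union L y
  ... | γ₁ , p₁ , x′ , x′≈x | γ₂ , p₂ , y′ , y′≈y with <-tri γ₁ γ₂
  ... | inj₁ γ₁<γ₂ = γ₂ , p₂ , ι (inj₂ γ₁<γ₂) x′ , y′ ,
        H.trans δ (ι-coh (inj₂ γ₁<γ₂) (inj₂ p₂) (inj₂ p₁) x′) x′≈x , y′≈y
  ... | inj₂ (inj₁ ≡.refl) = γ₁ , p₁ , x′ , y′ , x′≈x , H.trans δ (ι-irrelevant _ _ y′) y′≈y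
  ... | inj₂ (inj₂ γ₂<γ₁) = γ₁ , p₁ , x′ , ι (inj₂ γ₂<γ₁) y′ , x′≈x ,
        H.trans δ (ι-coh (inj₂ γ₂<γ₁) (inj₂ p₁) (inj₂ p₂) y′) y′≈y

  module Limit {δ} (L : IsLimit δ) (IH : ∀ {γ} → γ < δ → Good γ) where

    special-δ : Special (H δ) (ιA δ)
    special-δ x y st with common-stage L x y
    ... | γ , γ<δ , x′ , y′ , x′≈x , y′≈y =
      H.trans δ (H.sym δ x′≈x) (H.trans δ (ι-cong q x′≈y′) y′≈y)
      where
        q : γ ≤ δ
        q = inj₂ γ<δ
        open Homomorphism.Injective (H γ) (H δ) (ι q) (ι-cong q) (ι-hom q) (ι-inj q)
        x′≈y′ : H._≈_ γ x′ y′
        x′≈y′ = proj₁ (IH γ<δ) x′ y′ (SameQfType-reflect (ι-ιA q) x′ y′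
          (WordEvaluation.SameQfType-resp (H δ) (ιA δ) (H.sym δ x′≈x) (H.sym δ y′≈y) st))

    trivialCentralizer-δ : TrivialCentralizer (H δ) (ιA δ)
    trivialCentralizer-δ x comm with limit-union L x
    ... | γ , γ<δ , x′ , x′≈x =
      H.trans δ (H.sym δ x′≈x) (H.trans δ (ι-cong q x′≈ε) h-ε)
      where
        q : γ ≤ δ
        q = inj₂ γ<δ
        open Homomorphism (H γ) (H δ) (ι q) (ι-cong q) (ι-hom q)
        open Injective (ι-inj q)
        x′≈ε : H._≈_ γ x′ (H.ε γ)
        x′≈ε = proj₂ (IH γ<δ) x′ (centralizes-reflect (ι-ιA q) x′ λ a →
          H.trans δ (H.∙-congʳ δ x′≈x) (H.trans δ (comm a) (H.∙-congˡ δ (H.sym δ x′≈x))))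

    good : Good δ
    good = special-δ , trivialCentralizer-δ

  good : Centerless (H 𝟘) → Special (H 𝟘) proj₁ → ∀ α → Good α
  good centerless special = All.wfRec <-wf ℓ Good step
    where
      step : ∀ α → WfRec _<_ Good α → Good α
      step α IH with classify α
      ... | inj₁ ≡.refl          = good-𝟘 centerless special
      ... | inj₂ (inj₁ (β , s)) = good-succ s (IH (proj₁ s))
      ... | inj₂ (inj₂ L)       = Limit.good L IH

mainTheorem16 : ∀ {o r ℓ} (W : WellOrder o r) (H : WellOrder.O W → Group ℓ ℓ)
    (T : IsAutTower W H)
    (A : Group.Carrier (H (WellOrder.𝟘 W)) → Set ℓ) →
    Centerless (H (WellOrder.𝟘 W)) →
    Special (H (WellOrder.𝟘 W)) {P = Σ _ A} (λ a → proj₁ a) →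
    ∀ α →
      Special (H α) {P = Σ _ A} (λ a → IsAutTower.ι T (WellOrder.𝟘-least W α) (proj₁ a))
      × TrivialCentralizer (H α) {P = Σ _ A} (λ a → IsAutTower.ι T (WellOrder.𝟘-least W α) (proj₁ a))
mainTheorem16 W H T A = AutomorphismTower.good W H T A
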